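{- Let $\overline{\mathcal{L}} \subseteq \mathcal{L}$ be any subset of storage locations. Then for every order $o \in \mathcal{O}$ and every SKU $s \in \mathcal{S}(o)$, the inequality $$\sum_{r \in \mathcal{R}_o} \delta_r(\overline{\mathcal{L}})\, \rho_{or} \;\geq\; \sum_{l \in \overline{\mathcal{L}}} \xi_{ls}$$ is valid for formulation (DW), i.e. it is satisfied by every feasible solution $(\xi,\rho)$ of (DW).
   Context: Data of the Storage Location Assignment and Picker Routing Problem: a finite set $\mathcal{L}$ of storage locations, each $l\in\mathcal{L}$ with a positive integer capacity $K_l$; a finite set $\mathcal{S}$ of SKUs; a finite set $\mathcal{O}$ of orders, each $o\in\mathcal{O}$ with a set $\mathcal{S}(o)\subseteq\mathcal{S}$ of SKUs; a set $\mathcal{F}\subseteq \mathcal{S}\times\mathcal{L}$ of fixed assignments. Storage nodes: $\mathcal{V}=\bigcup_{l\in\mathcal{L}}\{v_l^1,\dots,v_l^{K_l}\}$, $\mathcal{V}(l)=\{v_l^1,\dots,v_l^{K_l}\}$, $\mathcal{V}^0=\mathcal{V}\cup\{v_0\}$ with $v_0$ the drop-off point. Directed graph $\mathcal{G}=(\mathcal{V}^0,\mathcal{E})$ with $\mathcal{E}=\{(v_0,v_l^1):l\in\mathcal{L}\}\cup\{(v_l^i,v_0)\}\cup\{(v_l^i,v_{l'}^1): l,l'\in\mathcal{L}\}\cup\{(v_l^i,v_l^{i+1}): 1\le i\le K_l-1\}$ (indices $i$ ranging over $1,\dots,K_l$). For each order $o$, $\mathcal{R}_o$ is the finite set of routes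 for $o$: tours in $\mathcal{G}$ starting and ending at $v_0$, visiting each node at most once, and visiting exactly $|\mathcal{S}(o)|$ storage nodes. Each route $r\in\mathcal{R}_o$ has a cost $c_{or}\in\mathbb{R}$; $a_{or}^l$ denotes the number of nodes of $\mathcal{V}(l)$ visited by $r$ (so $a_{or}^l\in\{0,\dots,K_l\}$ and $\sum_{l}a_{or}^l=|\mathcal{S}(o)|$); for $\overline{\mathcal{L}}\subseteq\mathcal{L}$, $\delta_r(\overline{\mathcal{L}})=1$ if $a_{or}^l\ge 1$ for some $l\in\overline{\mathcal{L}}$, and $0$ otherwise. Formulation (DW): minimize $\sum_{o}\sum_{r\in\mathcal{R}_o}c_{or}\rho_{or}$ subject to $\sum_{s\in\mathcal{S}}\xi_{ls}\le K_l$ for all $l\in\mathcal{L}$; $\sum_{l\in\mathcal{L}}\xi_{ls}=1$ for all $s\in\mathcal{S}$; $\xi_{ls}=1$ for all $(s,l)\in\mathcal{F}$; $\sum_{r\in\mathcal{R}_o}\rho_{or}=1$ for all $o\in\mathcal{O}$; $\sum_{r\in\mathcal{R}_o}a_{or}^l\rho_{or}\ge\sum_{s\in\mathcal{S}(o)}\xi_{ls}$ for all $l\in\mathcal{L},o\in\mathcal{O}$; $\rho_{or}\in\{0,1\}$, $\xi_{ls}\in\{0,1\}$. -}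

module Defs where

open import Data.Nat using (ℕ; zero; suc; _≤_; _≥_)
import Data.Nat as ℕ
open import Data.Bool using (Bool; true; false; _∧_; _∨_; not; if_then_else_)
open import Data.Fin using (Fin; toℕ)
import Data.Fin as Fin
open import Data.Fin.Subset using (Subset; _∈_; ∣_∣)
open import Data.Fin.Subset.Properties using (_∈?_)
open import Data.List using (List; []; _∷_; map; concatMap; allFin; filterᵇ; length)
open import Data.Nat.ListAction using (sum)
open import Data.List.Membership.Propositional renaming (_∈_ to _∈ₗ_)
open import Data.Product using (Σ; _×_; _,_; proj₁; proj₂)
open import Relation.Nullary.Decidable using (⌊_⌋)
open import Relation.Binary.PropositionalEquality using (_≡_)

record Instance : Set where
  field
    nL nS nO : ℕ
    K        : Fin nL → ℕ
    K-pos    : ∀ l → 1 ≤ K l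
    SKUs     : Fin nO → Subset nS
    Fixed    : List (Fin nS × Fin nL)

module _ (I : Instance) where
  open Instance I

  -- Storage node v_l^{i+1} is represented by (l , i) with i : Fin (K l).
  Node : Set
  Node = Σ (Fin nL) (λ l → Fin (K l))

  loc : Node → Fin nL
  loc = proj₁

  sameNode : Node → Node → Bool
  sameNode p q = ⌊ proj₁ p Fin.≟ proj₁ q ⌋ ∧ ⌊ toℕ (proj₂ p) ℕ.≟ toℕ (proj₂ q) ⌋

  -- (v_l^1 , ...) : the edge from v_0 leads only to first nodes v_l^1
  isFirst : Node → Bool
  isFirst p = ⌊ toℕ (proj₂ p) ℕ.≟ 0 ⌋

  -- edge (p , q) between storage nodes of E:
  --   (v_l^i , v_{l'}^1)  or  (v_l^i , v_l^{i+1})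
  isEdge : Node → Node → Bool
  isEdge p q = isFirst q ∨ (⌊ proj₁ p Fin.≟ proj₁ q ⌋ ∧ ⌊ toℕ (proj₂ q) ℕ.≟ suc (toℕ (proj₂ p)) ⌋)

  linked : List Node → Bool
  linked []           = true
  linked (p ∷ [])     = true
  linked (p ∷ q ∷ ps) = isEdge p q ∧ linked (q ∷ ps)

  notIn : Node → List Node → Bool
  notIn p []       = true
  notIn p (q ∷ qs) = not (sameNode p q) ∧ notIn p qs

  distinct : List Node → Bool
  distinct []       = true
  distinct (p ∷ ps) = notIn p ps ∧ distinct ps

  startsOK : List Node → Bool
  startsOK []      = true
  startsOK (p ∷ _) = isFirst p

  -- A tour v_0 → p_1 → … → p_m → v_0 in G is given by its list of storage
  -- nodes p_1 … p_m (edges (p_m , v_0) always exist).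
  isRoute : Fin nO → List Node → Bool
  isRoute o r = ⌊ length r ℕ.≟ ∣ SKUs o ∣ ⌋ ∧ startsOK r ∧ linked r ∧ distinct r

  allNodes : List Node
  allNodes = concatMap (λ l → map (λ i → (l , i)) (allFin (K l))) (allFin nL)

  listsOfLength : {A : Set} → List A → ℕ → List (List A)
  listsOfLength xs zero    = [] ∷ []
  listsOfLength xs (suc m) = concatMap (λ x → map (x ∷_) (listsOfLength xs m)) xs

  routes : Fin nO → List (List Node)
  routes o = filterᵇ (isRoute o) (listsOfLength allNodes ∣ SKUs o ∣)

  a : List Node → Fin nL → ℕ
  a []       l = 0
  a (p ∷ ps) l = (if ⌊ loc p Fin.≟ l ⌋ then 1 else 0) ℕ.+ a ps l

  visits : List Node → Subset nL → Bool
  visits []       Lb = false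
  visits (p ∷ ps) Lb = ⌊ loc p ∈? Lb ⌋ ∨ visits ps Lb

  δ : List Node → Subset nL → ℕ
  δ r Lb = if visits r Lb then 1 else 0

  Σ-over : {A : Set} → List A → (A → ℕ) → ℕ
  Σ-over xs f = sum (map f xs)

  Σ-in : {n : ℕ} → Subset n → (Fin n → ℕ) → ℕ
  Σ-in P f = Σ-over (allFin _) (λ i → if ⌊ i ∈? P ⌋ then f i else 0)

  -- Variables: ξ l s  and  ρ o r  (ρ is read only on r ∈ R_o).
  Xi : Set
  Xi = Fin nL → Fin nS → ℕ

  Rho : Set
  Rho = Fin nO → List Node → ℕ

  record Feasible (ξ : Xi) (ρ : Rho) : Set where
    field
      capacity   : ∀ l → Σ-over (allFin nS) (λ s → ξ l s) ≤ K l
      assigned   : ∀ s → Σ-over (allFin nL) (λ l → ξ l s) ≡ 1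
      fixed      : ∀ s l → (s , l) ∈ₗ Fixed → ξ l s ≡ 1
      convexity  : ∀ o → Σ-over (routes o) (λ r → ρ o r) ≡ 1
      linking    : ∀ l o → Σ-over (routes o) (λ r → a r l ℕ.* ρ o r)
                             ≥ Σ-in (SKUs o) (λ s → ξ l s)
      ρ-binary   : ∀ o r → r ∈ₗ routes o → ρ o r ≤ 1
      ξ-binary   : ∀ l s → ξ l s ≤ 1

-- Every SKU is stored in exactly one location, so the right-hand side is 0 or 1.
-- If it is 1, s is stored at some l ∈ L̄; the linking constraint of (l , o) then
-- forces some selected route r of o (ρ_or ≥ 1) to visit l, so δ_r(L̄) = 1 and the
-- left-hand side is at least δ_r(L̄) ρ_or ≥ 1.
module Submission where

open import Defs
open import Data.Nat using (_≥_; _*_)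
open import Data.Fin.Subset using (Subset; _∈_)

open import Data.Bool using (true; _∨_; if_then_else_)
open import Data.Bool.Properties using (∨-zeroʳ)
open import Data.Fin using (Fin)
import Data.Fin as Fin
open import Data.Fin.Subset.Properties using (_∈?_)
open import Data.List using (List; []; _∷_; map; allFin)
open import Data.List.Membership.Propositional renaming (_∈_ to _∈ₗ_)
open import Data.List.Membership.Propositional.Properties using (∈-allFin)
open import Data.List.Relation.Unary.Any using (here; there)
open import Data.Nat using (ℕ; zero; suc; _≤_; _<_; z≤n; s≤s; z<s)
open import Data.Nat.ListAction using (sum)
open import Data.Nat.Properties
open import Data.Product using (∃; _×_; _,_)
open import Relation.Nullary using (yes; no; contradiction)
open import Relation.Nullary.Decidable using (⌊_⌋)
open import Relation.Binary.PropositionalEquality using (_≡_; refl; sym; trans; cong; subst)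

m≤1⇒[m>0⇒n>0]⇒m≤n : ∀ {m n} → m ≤ 1 → (0 < m → 0 < n) → m ≤ n
m≤1⇒[m>0⇒n>0]⇒m≤n {zero}        _         _   = z≤n
m≤1⇒[m>0⇒n>0]⇒m≤n {suc zero}    _         m>0 = m>0 z<s
m≤1⇒[m>0⇒n>0]⇒m≤n {suc (suc _)} (s≤s ()) _

m*n>0⇒m>0×n>0 : ∀ m n → 0 < m * n → 0 < m × 0 < n
m*n>0⇒m>0×n>0 zero    _       ()
m*n>0⇒m>0×n>0 (suc m) (suc n) _    = z<s , z<s
m*n>0⇒m>0×n>0 (suc m) zero    mn>0 = contradiction (subst (0 <_) (*-zeroʳ (suc m)) mn>0) n≮0

module _ {A : Set} where

  ∈⇒≤sum-map : (f : A → ℕ) {x : A} {xs : List A} → x ∈ₗ xs → f x ≤ sum (map f xs)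
  ∈⇒≤sum-map f {xs = y ∷ ys} (here refl) = m≤m+n (f y) _
  ∈⇒≤sum-map f {xs = y ∷ ys} (there x∈ys) = ≤-trans (∈⇒≤sum-map f x∈ys) (m≤n+m _ (f y))

  sum-map-mono-≤ : {f g : A → ℕ} (xs : List A) → (∀ x → f x ≤ g x) → sum (map f xs) ≤ sum (map g xs)
  sum-map-mono-≤ []       _   = z≤n
  sum-map-mono-≤ (y ∷ ys) f≤g = +-mono-≤ (f≤g y) (sum-map-mono-≤ ys f≤g)

  sum-map>0⇒∃>0 : (f : A → ℕ) (xs : List A) → 0 < sum (map f xs) → ∃ λ x → x ∈ₗ xs × 0 < f x
  sum-map>0⇒∃>0 f []       ()
  sum-map>0⇒∃>0 f (y ∷ ys) sum>0 with f y in fy≡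
  ... | suc _ = y , here refl , subst (0 <_) (sym fy≡) z<s
  ... | zero  = let x , x∈ys , fx>0 = sum-map>0⇒∃>0 f ys sum>0 in x , there x∈ys , fx>0

-- Σ-in ignores its instance argument; I is only there to fill it.
module _ (I : Instance) {n : ℕ} (P : Subset n) (f : Fin n → ℕ) where

  Σ-in≤Σ-over : Σ-in I P f ≤ Σ-over I (allFin n) f
  Σ-in≤Σ-over = sum-map-mono-≤ (allFin n) restrict≤
    where
    restrict≤ : ∀ i → (if ⌊ i ∈? P ⌋ then f i else 0) ≤ f i
    restrict≤ i with i ∈? P
    ... | yes _ = ≤-refl
    ... | no  _ = z≤n

  ∈⇒≤Σ-in : ∀ {i} → i ∈ P → f i ≤ Σ-in I P f
  ∈⇒≤Σ-in {i} i∈P with i ∈? P | ∈⇒≤sum-map (λ j → if ⌊ j ∈? P ⌋ then f j else 0) (∈-allFin i)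
  ... | yes _ | fi≤Σ = fi≤Σ
  ... | no i∉P | _   = contradiction i∈P i∉P

  Σ-in>0⇒∃>0 : 0 < Σ-in I P f → ∃ λ i → i ∈ P × 0 < f i
  Σ-in>0⇒∃>0 Σ>0 with sum-map>0⇒∃>0 _ (allFin n) Σ>0
  ... | i , _ , fi>0 with i ∈? P
  ...   | yes i∈P = i , i∈P , fi>0
  ...   | no  _   = contradiction fi>0 n≮0

module _ (I : Instance) {Lb : Subset (Instance.nL I)} {l : Fin (Instance.nL I)} where

  a>0⇒visits : (r : List (Node I)) → l ∈ Lb → 0 < a I r l → visits I r Lb ≡ true
  a>0⇒visits []       _    ()
  a>0⇒visits (p ∷ ps) l∈Lb a>0 with loc I p Fin.≟ l
  ... | no _ = trans (cong (⌊ loc I p ∈? Lb ⌋ ∨_) (a>0⇒visits ps l∈Lb a>0)) (∨-zeroʳ _)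
  ... | yes refl with loc I p ∈? Lb
  ...   | yes _    = refl
  ...   | no l∉Lb  = contradiction l∈Lb l∉Lb

  δ*-visiting : (r : List (Node I)) → l ∈ Lb → 0 < a I r l → ∀ m → δ I r Lb * m ≡ m
  δ*-visiting r l∈Lb a>0 m rewrite a>0⇒visits r l∈Lb a>0 = *-identityˡ m

theorem1 : (I : Instance) → (Lb : Subset (Instance.nL I)) → (ξ : Xi I) → (ρ : Rho I) →
    Feasible I ξ ρ →
    ∀ o s → s ∈ Instance.SKUs I o →
    Σ-over I (routes I o) (λ r → δ I r Lb * ρ o r) ≥ Σ-in I Lb (λ l → ξ l s)
theorem1 I Lb ξ ρ F o s s∈o = m≤1⇒[m>0⇒n>0]⇒m≤n stored-in-Lb≤1 stored-in-Lb⇒visited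
  where
  open Instance I
  open Feasible F

  stored-in-Lb≤1 : Σ-in I Lb (λ l → ξ l s) ≤ 1
  stored-in-Lb≤1 = ≤-trans (Σ-in≤Σ-over I Lb (λ l → ξ l s)) (≤-reflexive (assigned s))

  stored-in-Lb⇒visited : 0 < Σ-in I Lb (λ l → ξ l s) →
                         0 < Σ-over I (routes I o) (λ r → δ I r Lb * ρ o r)
  stored-in-Lb⇒visited stored>0 =
    let l , l∈Lb , ξls>0 = Σ-in>0⇒∃>0 I Lb (λ l → ξ l s) stored>0
        demand>0 = <-≤-trans ξls>0 (≤-trans (∈⇒≤Σ-in I (SKUs o) (ξ l) s∈o) (linking l o))
        r , r∈Ro , aρ>0 = sum-map>0⇒∃>0 (λ r → a I r l * ρ o r) (routes I o) demand>0
        a>0 , ρ>0 = m*n>0⇒m>0×n>0 (a I r l) (ρ o r) aρ>0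
        δρ>0 = subst (0 <_) (sym (δ*-visiting I r l∈Lb a>0 (ρ o r))) ρ>0
    in <-≤-trans δρ>0 (∈⇒≤sum-map (λ r → δ I r Lb * ρ o r) r∈Ro)
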